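{- Let $M$ be a matroid on a finite set $E$ and let $\mathcal{I}$ be a modular ideal of $M$. Then $\mathcal{I}$ equals the family consisting of all independent sets of $M$ together with all sets $S\subseteq E$ for which there is a basis $B$ of $S$ with $F_B(S)\subseteq\mathcal{I}$.
   Context: Distinct sets $S,T\subseteq E$ form a modular pair if $\operatorname{rk}(S\cap T)+\operatorname{rk}(S\cup T)=\operatorname{rk}S+\operatorname{rk}T$. A modular ideal of $M$ is a nonempty down-closed family $\mathcal{I}\subseteq\mathcal{P}(E)$ (possibly all of $\mathcal{P}(E)$) such that $\{e\}\in\mathcal{I}$ for every non-loop $e$, and $A\cup B\in\mathcal{I}$ for every modular pair $A,B\in\mathcal{I}$. A basis of $S$ is a maximal independent subset of $S$. For an independent set $B$ and $s\notin B$ with $B\cup\{s\}$ dependent, $C_B(s)$ denotes the unique circuit with $s\in C_B(s)\subseteq B\cup\{s\}$ (fundamental circuit). For a basis $B$ of $S$, $F_B(S)=\{C_B(s): s\in S\setminus B\}$. -}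

module Defs where

open import Data.Nat using (ℕ; _≤_; _+_)
open import Data.Fin using (Fin)
open import Data.Fin.Subset using (Subset; _⊆_; _∪_; _∩_; ∣_∣; ⁅_⁆; _∈_; _∉_; _-_)
open import Data.Product using (Σ; ∃; _×_)
open import Data.Sum using (_⊎_)
open import Relation.Binary.PropositionalEquality using (_≡_; _≢_)
open import Relation.Nullary using (¬_)

record Matroid (n : ℕ) : Set where
  field
    rk          : Subset n → ℕ
    rk-bound    : ∀ S → rk S ≤ ∣ S ∣
    rk-mono     : ∀ {S T} → S ⊆ T → rk S ≤ rk T
    rk-submod   : ∀ S T → rk (S ∪ T) + rk (S ∩ T) ≤ rk S + rk T

module _ {n : ℕ} (M : Matroid n) where
  open Matroid M

  Independent : Subset n → Set
  Independent S = rk S ≡ ∣ S ∣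

  Loop : Fin n → Set
  Loop e = rk ⁅ e ⁆ ≡ 0

  Circuit : Subset n → Set
  Circuit C = ¬ Independent C × (∀ e → e ∈ C → Independent (C - e))

  ModularPair : Subset n → Subset n → Set
  ModularPair S T = S ≢ T × (rk (S ∩ T) + rk (S ∪ T) ≡ rk S + rk T)

  IsBasisOf : Subset n → Subset n → Set
  IsBasisOf B S = B ⊆ S × Independent B
                × (∀ T → B ⊆ T → T ⊆ S → Independent T → T ≡ B)

  -- C is the fundamental circuit C_B(s): the (unique) circuit with s ∈ C ⊆ B ∪ {s}
  IsFundCircuit : Subset n → Fin n → Subset n → Set
  IsFundCircuit B s C = Circuit C × s ∈ C × C ⊆ (B ∪ ⁅ s ⁆)

  FundCircuitsIn : Subset n → Subset n → (Subset n → Set) → Set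
  FundCircuitsIn B S 𝓘 =
    ∀ s → s ∈ S → s ∉ B → ∀ C → IsFundCircuit B s C → 𝓘 C

  record ModularIdeal (𝓘 : Subset n → Set) : Set where
    field
      nonempty    : ∃ λ S → 𝓘 S
      down-closed : ∀ {S T} → T ⊆ S → 𝓘 S → 𝓘 T
      nonloops    : ∀ e → ¬ Loop e → 𝓘 ⁅ e ⁆
      modular-∪   : ∀ A B → 𝓘 A → 𝓘 B → ModularPair A B → 𝓘 (A ∪ B)

-- Everything rests on one gluing step: if s ∈ C ⊆ X and removing s lowers the
-- rank of X at least as much as that of C, then X - s and C form a modular pair
-- with union X.  Independent sets are assembled from singletons this way
-- (removing an element lowers both ranks by one).  For a basis B of S, every
-- set between B and S is assembled from B and fundamental circuits: s ∈ X \ B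
-- lies in the circuit C_B(s) ⊆ X, and removing an element of a circuit lowers
-- the rank of neither C nor X.  Conversely F_B(S) ⊆ 𝓘 whenever S ∈ 𝓘, since
-- every C_B(s) is a subset of S.
module Submission where

open import Defs
open import Data.Nat using (ℕ; suc; _≤_; _+_; _≟_; z≤n)
open import Data.Nat.Properties
  using (≤-antisym; ≤-pred; ≤∧≢⇒<; +-comm; +-mono-≤; +-monoʳ-≤; m≤n+m; 1+n≢0; module ≤-Reasoning)
open import Data.Fin using (Fin)
open import Data.Fin.Subset
  using (Subset; _⊆_; _⊂_; _∪_; _∩_; _─_; _-_; ∣_∣; ⁅_⁆; ⊥; _∈_; _∉_; inside; outside)
open import Data.Fin.Subset.Properties
  using (_∈?_; nonempty?; ⊆-refl; ⊆-trans; ⊆-antisym; ⊆-min; p⊆p∪q; q⊆p∪q; x∈p∪q⁺; x∈p∪q⁻;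
         x∈p∩q⁺; x∈p∩q⁻; p─q⊆p; p─⊥≡p; x∈p∧x∉q⇒x∈p─q; x∈⁅x⁆; x∈⁅y⁆⇒x≡y; ∣⁅x⁆∣≡1; ∣⊥∣≡0;
         x∈p⇒p-x⊂p)
open import Data.Fin.Subset.Induction using (⊂-wellFounded; ⊃-wellFounded)
open import Data.Fin.Properties using (any?)
open import Data.Product using (∃; _×_; _,_; proj₁; proj₂)
open import Data.Sum using (_⊎_; inj₁; inj₂; [_,_]′)
open import Data.Vec using (_∷_; here; there)
open import Data.Empty using (⊥-elim)
open import Function using (id; _∘_; case_of_)
open import Function.Bundles using (_⇔_; mk⇔)
open import Induction.WellFounded using (WfRec; module All)
open import Level using (0ℓ)
open import Relation.Nullary using (¬_; Dec; yes; no; ¬?)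
open import Relation.Nullary.Decidable using (_×-dec_; decidable-stable)
open import Relation.Binary.PropositionalEquality using (_≡_; sym; trans; cong; subst; subst₂)

x∈p─q⇒x∉q : ∀ {n} {x : Fin n} (p q : Subset n) → x ∈ p ─ q → x ∉ q
x∈p─q⇒x∉q (inside ∷ p) (outside ∷ q) here        ()
x∈p─q⇒x∉q (_      ∷ p) (inside  ∷ q) (there x∈) (there x∈q) = x∈p─q⇒x∉q p q x∈ x∈q
x∈p─q⇒x∉q (_      ∷ p) (outside ∷ q) (there x∈) (there x∈q) = x∈p─q⇒x∉q p q x∈ x∈q

x∉p-x : ∀ {n} {x : Fin n} {p} → x ∉ p - x
x∉p-x {x = x} {p = p} x∈p-x = x∈p─q⇒x∉q p ⁅ x ⁆ x∈p-x (x∈⁅x⁆ x)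

x∈p⇒suc∣p-x∣≡∣p∣ : ∀ {n} {x : Fin n} {p} → x ∈ p → suc ∣ p - x ∣ ≡ ∣ p ∣
x∈p⇒suc∣p-x∣≡∣p∣ {p = inside  ∷ p} here        = cong (suc ∘ ∣_∣) (p─⊥≡p p)
x∈p⇒suc∣p-x∣≡∣p∣ {p = inside  ∷ p} (there x∈p) = cong suc (x∈p⇒suc∣p-x∣≡∣p∣ x∈p)
x∈p⇒suc∣p-x∣≡∣p∣ {p = outside ∷ p} (there x∈p) = x∈p⇒suc∣p-x∣≡∣p∣ x∈p

x∈p⇒⁅x⁆⊆p : ∀ {n} {x : Fin n} {p} → x ∈ p → ⁅ x ⁆ ⊆ p
x∈p⇒⁅x⁆⊆p {x = x} {p = p} x∈p y∈⁅x⁆ = subst (_∈ p) (sym (x∈⁅y⁆⇒x≡y x y∈⁅x⁆)) x∈p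

∪-lub : ∀ {n} {p q r : Subset n} → p ⊆ r → q ⊆ r → p ∪ q ⊆ r
∪-lub {p = p} {q = q} p⊆r q⊆r x∈p∪q = [ p⊆r , q⊆r ]′ (x∈p∪q⁻ p q x∈p∪q)

p⊆q∧x∉p⇒p⊆q-x : ∀ {n} {p q : Subset n} {x} → p ⊆ q → x ∉ p → p ⊆ q - x
p⊆q∧x∉p⇒p⊆q-x {p = p} {x = x} p⊆q x∉p y∈p =
  x∈p∧x∉q⇒x∈p─q (p⊆q y∈p) (λ y∈⁅x⁆ → x∉p (subst (_∈ p) (x∈⁅y⁆⇒x≡y x y∈⁅x⁆) y∈p))

⊆-or-∃∈∉ : ∀ {n} (p q : Subset n) → p ⊆ q ⊎ ∃ λ x → x ∈ p × x ∉ q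
⊆-or-∃∈∉ p q with any? (λ x → x ∈? p ×-dec ¬? (x ∈? q))
... | yes witness = inj₂ witness
... | no none     = inj₁ λ {x} x∈p → decidable-stable (x ∈? q) (λ x∉q → none (x , x∈p , x∉q))

x∈q⊆p⇒p-x∪q≡p : ∀ {n} {x : Fin n} {p q} → x ∈ q → q ⊆ p → (p - x) ∪ q ≡ p
x∈q⊆p⇒p-x∪q≡p {x = x} {p = p} {q = q} x∈q q⊆p =
  ⊆-antisym (∪-lub (p─q⊆p p ⁅ x ⁆) q⊆p) λ {y} y∈p → case y ∈? ⁅ x ⁆ of λ
    { (yes y∈⁅x⁆) → x∈p∪q⁺ (inj₂ (subst (_∈ q) (sym (x∈⁅y⁆⇒x≡y x y∈⁅x⁆)) x∈q))
    ; (no y∉⁅x⁆)  → x∈p∪q⁺ (inj₁ (x∈p∧x∉q⇒x∈p─q y∈p y∉⁅x⁆)) }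

q⊆p⇒p-x∩q≡q-x : ∀ {n} {p q : Subset n} {x} → q ⊆ p → (p - x) ∩ q ≡ q - x
q⊆p⇒p-x∩q≡q-x {p = p} {q = q} {x = x} q⊆p = ⊆-antisym
  (λ y∈ → let (y∈p-x , y∈q) = x∈p∩q⁻ (p - x) q y∈ in
    x∈p∧x∉q⇒x∈p─q y∈q (x∈p─q⇒x∉q p ⁅ x ⁆ y∈p-x))
  (λ y∈q-x → x∈p∩q⁺ ( x∈p∧x∉q⇒x∈p─q (q⊆p (p─q⊆p q ⁅ x ⁆ y∈q-x)) (x∈p─q⇒x∉q q ⁅ x ⁆ y∈q-x)
                    , p─q⊆p q ⁅ x ⁆ y∈q-x))

module MatroidProperties {n : ℕ} (M : Matroid n) where
  open Matroid M

  independent? : ∀ X → Dec (Independent M X)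
  independent? X = rk X ≟ ∣ X ∣

  independent-⊥ : Independent M ⊥
  independent-⊥ = ≤-antisym (rk-bound ⊥) (subst (_≤ rk ⊥) (sym (∣⊥∣≡0 n)) z≤n)

  rk-submodular : ∀ A B → rk (A ∩ B) + rk (A ∪ B) ≤ rk A + rk B
  rk-submodular A B = subst (_≤ rk A + rk B) (+-comm (rk (A ∪ B)) (rk (A ∩ B))) (rk-submod A B)

  submodular-tight : ∀ A B → rk A + rk B ≤ rk (A ∩ B) + rk (A ∪ B) →
                     rk (A ∩ B) + rk (A ∪ B) ≡ rk A + rk B
  submodular-tight A B supermodular = ≤-antisym (rk-submodular A B) supermodular

  removal-modular : ∀ {X C s} → s ∈ C → C ⊆ X →
                    rk (X - s) + rk C ≤ rk (C - s) + rk X → ModularPair M (X - s) C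
  removal-modular {X} {C} {s} s∈C C⊆X rank-drop =
      (λ X-s≡C → x∉p-x (subst (s ∈_) (sym X-s≡C) s∈C))
    , submodular-tight (X - s) C
        (subst₂ (λ I U → rk (X - s) + rk C ≤ rk I + rk U)
                (sym (q⊆p⇒p-x∩q≡q-x C⊆X)) (sym (x∈q⊆p⇒p-x∪q≡p s∈C C⊆X)) rank-drop)

  independent-remove : ∀ {I e} → e ∈ I → Independent M I → Independent M (I - e)
  independent-remove {I} {e} e∈I indI = ≤-antisym (rk-bound (I - e)) (≤-pred (begin
    suc ∣ I - e ∣                          ≡⟨ x∈p⇒suc∣p-x∣≡∣p∣ e∈I ⟩
    ∣ I ∣                                  ≡⟨ sym indI ⟩
    rk I                                   ≡⟨ cong rk (sym (x∈q⊆p⇒p-x∪q≡p (x∈⁅x⁆ e) (x∈p⇒⁅x⁆⊆p e∈I))) ⟩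
    rk ((I - e) ∪ ⁅ e ⁆)                     ≤⟨ m≤n+m _ _ ⟩
    rk ((I - e) ∩ ⁅ e ⁆) + rk ((I - e) ∪ ⁅ e ⁆) ≤⟨ rk-submodular (I - e) ⁅ e ⁆ ⟩
    rk (I - e) + rk ⁅ e ⁆                  ≤⟨ +-monoʳ-≤ (rk (I - e)) (rk-bound ⁅ e ⁆) ⟩
    rk (I - e) + ∣ ⁅ e ⁆ ∣                  ≡⟨ cong (rk (I - e) +_) (∣⁅x⁆∣≡1 e) ⟩
    rk (I - e) + 1                         ≡⟨ +-comm _ 1 ⟩
    suc (rk (I - e))                       ∎))
    where open ≤-Reasoning

  independent-⊆ : ∀ {X I} → X ⊆ I → Independent M I → Independent M X
  independent-⊆ {X} {I} = All.wfRec ⊂-wellFounded 0ℓ P step I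
    where
    P : Subset n → Set
    P I = X ⊆ I → Independent M I → Independent M X
    step : ∀ I → WfRec _⊂_ P I → P I
    step I rec X⊆I indI with ⊆-or-∃∈∉ I X
    ... | inj₁ I⊆X             = subst (Independent M) (⊆-antisym I⊆X X⊆I) indI
    ... | inj₂ (e , e∈I , e∉X) =
      rec (x∈p⇒p-x⊂p e∈I) (p⊆q∧x∉p⇒p⊆q-x X⊆I e∉X) (independent-remove e∈I indI)

  independent-modular : ∀ {I e} → Independent M I → e ∈ I → ModularPair M (I - e) ⁅ e ⁆
  independent-modular {I} {e} indI e∈I = removal-modular (x∈⁅x⁆ e) (x∈p⇒⁅x⁆⊆p e∈I) (begin
    rk (I - e) + rk ⁅ e ⁆      ≤⟨ +-mono-≤ (rk-bound (I - e)) (rk-bound ⁅ e ⁆) ⟩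
    ∣ I - e ∣ + ∣ ⁅ e ⁆ ∣       ≡⟨ cong (∣ I - e ∣ +_) (∣⁅x⁆∣≡1 e) ⟩
    ∣ I - e ∣ + 1               ≡⟨ +-comm _ 1 ⟩
    suc ∣ I - e ∣              ≡⟨ x∈p⇒suc∣p-x∣≡∣p∣ e∈I ⟩
    ∣ I ∣                      ≡⟨ sym indI ⟩
    rk I                       ≤⟨ m≤n+m _ _ ⟩
    rk (⁅ e ⁆ - e) + rk I       ∎)
    where open ≤-Reasoning

  independent⇒¬loop : ∀ {I e} → Independent M I → e ∈ I → ¬ Loop M e
  independent⇒¬loop {I} {e} indI e∈I loop =
    1+n≢0 (trans (sym (∣⁅x⁆∣≡1 e)) (trans (sym (independent-⊆ (x∈p⇒⁅x⁆⊆p e∈I) indI)) loop))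

  circuit-rk-≤ : ∀ {C s} → Circuit M C → s ∈ C → rk C ≤ rk (C - s)
  circuit-rk-≤ {C} {s} (dependent , minimal) s∈C = ≤-pred (begin-strict
    rk C              <⟨ ≤∧≢⇒< (rk-bound C) dependent ⟩
    ∣ C ∣             ≡⟨ sym (x∈p⇒suc∣p-x∣≡∣p∣ s∈C) ⟩
    suc ∣ C - s ∣     ≡⟨ cong suc (sym (minimal s s∈C)) ⟩
    suc (rk (C - s))  ∎)
    where open ≤-Reasoning

  circuit-modular : ∀ {X C s} → Circuit M C → s ∈ C → C ⊆ X → ModularPair M (X - s) C
  circuit-modular {X} {C} {s} circ s∈C C⊆X = removal-modular s∈C C⊆X
    (subst (rk (X - s) + rk C ≤_) (+-comm (rk X) (rk (C - s)))
      (+-mono-≤ (rk-mono (p─q⊆p X ⁅ s ⁆)) (circuit-rk-≤ circ s∈C)))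

  dependent⇒circuit : ∀ D → ¬ Independent M D → ∃ λ C → C ⊆ D × Circuit M C
  dependent⇒circuit = All.wfRec ⊂-wellFounded 0ℓ P step
    where
    P : Subset n → Set
    P D = ¬ Independent M D → ∃ λ C → C ⊆ D × Circuit M C
    step : ∀ D → WfRec _⊂_ P D → P D
    step D rec dep with any? (λ e → e ∈? D ×-dec ¬? (independent? (D - e)))
    ... | yes (e , e∈D , dep-e) =
      let (C , C⊆D-e , circ) = rec (x∈p⇒p-x⊂p e∈D) dep-e
      in C , ⊆-trans C⊆D-e (p─q⊆p D ⁅ e ⁆) , circ
    ... | no none = D , ⊆-refl , dep , λ e e∈D →
      decidable-stable (independent? (D - e)) (λ dep-e → none (e , e∈D , dep-e))

  fundamental-circuit : ∀ {B s} → Independent M B → ¬ Independent M (B ∪ ⁅ s ⁆) →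
                        ∃ (IsFundCircuit M B s)
  fundamental-circuit {B} {s} indB dep with dependent⇒circuit (B ∪ ⁅ s ⁆) dep
  ... | C , C⊆B∪s , circ with s ∈? C
  ...   | yes s∈C = C , circ , s∈C , C⊆B∪s
  ...   | no s∉C  = ⊥-elim (proj₁ circ (independent-⊆ C⊆B indB))
    where
    C⊆B : C ⊆ B
    C⊆B x∈C = [ id , (λ x∈⁅s⁆ → ⊥-elim (s∉C (subst (_∈ C) (x∈⁅y⁆⇒x≡y s x∈⁅s⁆) x∈C))) ]′
                (x∈p∪q⁻ B ⁅ s ⁆ (C⊆B∪s x∈C))

  extend-to-basis : ∀ {S} B → B ⊆ S → Independent M B → ∃ λ B′ → IsBasisOf M B′ S
  extend-to-basis {S} = All.wfRec ⊃-wellFounded 0ℓ P step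
    where
    P : Subset n → Set
    P B = B ⊆ S → Independent M B → ∃ λ B′ → IsBasisOf M B′ S
    step : ∀ B → WfRec (λ B B′ → B′ ⊂ B) P B → P B
    step B rec B⊆S indB with any? (λ x → x ∈? S ×-dec ¬? (x ∈? B) ×-dec independent? (B ∪ ⁅ x ⁆))
    ... | yes (x , x∈S , x∉B , indB∪x) =
      rec (p⊆p∪q ⁅ x ⁆ , x , q⊆p∪q B ⁅ x ⁆ (x∈⁅x⁆ x) , x∉B) (∪-lub B⊆S (x∈p⇒⁅x⁆⊆p x∈S)) indB∪x
    ... | no none = B , B⊆S , indB , maximal
      where
      maximal : ∀ T → B ⊆ T → T ⊆ S → Independent M T → T ≡ B
      maximal T B⊆T T⊆S indT = ⊆-antisym (λ {x} x∈T → decidable-stable (x ∈? B) λ x∉B →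
        none (x , T⊆S x∈T , x∉B , independent-⊆ (∪-lub B⊆T (x∈p⇒⁅x⁆⊆p x∈T)) indT)) B⊆T

  basis-exists : ∀ S → ∃ λ B → IsBasisOf M B S
  basis-exists S = extend-to-basis ⊥ (⊆-min S) independent-⊥

  basis-∪-dependent : ∀ {B S s} → IsBasisOf M B S → s ∈ S → s ∉ B → ¬ Independent M (B ∪ ⁅ s ⁆)
  basis-∪-dependent {B} {s = s} (B⊆S , _ , maximal) s∈S s∉B indB∪s =
    s∉B (subst (s ∈_) (maximal _ (p⊆p∪q ⁅ s ⁆) (∪-lub B⊆S (x∈p⇒⁅x⁆⊆p s∈S)) indB∪s)
                      (q⊆p∪q B ⁅ s ⁆ (x∈⁅x⁆ s)))

  module _ {𝓘 : Subset n → Set} (𝓘-modular : ModularIdeal M 𝓘) where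
    open ModularIdeal 𝓘-modular

    modular-∪-removal : ∀ {X C s} → 𝓘 (X - s) → 𝓘 C → s ∈ C → C ⊆ X →
                        ModularPair M (X - s) C → 𝓘 X
    modular-∪-removal {X} {C} 𝓘X-s 𝓘C s∈C C⊆X modular =
      subst 𝓘 (x∈q⊆p⇒p-x∪q≡p s∈C C⊆X) (modular-∪ _ C 𝓘X-s 𝓘C modular)

    independent⇒∈ideal : ∀ I → Independent M I → 𝓘 I
    independent⇒∈ideal = All.wfRec ⊂-wellFounded 0ℓ P step
      where
      P : Subset n → Set
      P I = Independent M I → 𝓘 I
      step : ∀ I → WfRec _⊂_ P I → P I
      step I rec indI with nonempty? I
      ... | no empty       = down-closed (λ x∈I → ⊥-elim (empty (_ , x∈I))) (proj₂ nonempty)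
      ... | yes (e , e∈I) = modular-∪-removal
        (rec (x∈p⇒p-x⊂p e∈I) (independent-remove e∈I indI))
        (nonloops e (independent⇒¬loop indI e∈I))
        (x∈⁅x⁆ e) (x∈p⇒⁅x⁆⊆p e∈I) (independent-modular indI e∈I)

    basis-spanned⇒∈ideal : ∀ {B S} → IsBasisOf M B S → FundCircuitsIn M B S 𝓘 →
                           ∀ X → B ⊆ X → X ⊆ S → 𝓘 X
    basis-spanned⇒∈ideal {B} {S} B-basis@(_ , indB , _) F⊆𝓘 = All.wfRec ⊂-wellFounded 0ℓ P step
      where
      P : Subset n → Set
      P X = B ⊆ X → X ⊆ S → 𝓘 X
      step : ∀ X → WfRec _⊂_ P X → P X
      step X rec B⊆X X⊆S with ⊆-or-∃∈∉ X B
      ... | inj₁ X⊆B = independent⇒∈ideal X (independent-⊆ X⊆B indB)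
      ... | inj₂ (s , s∈X , s∉B)
            with fundamental-circuit indB (basis-∪-dependent B-basis (X⊆S s∈X) s∉B)
      ...   | C , C-fund@(circ , s∈C , C⊆B∪s) = modular-∪-removal
        (rec (x∈p⇒p-x⊂p s∈X) (p⊆q∧x∉p⇒p⊆q-x B⊆X s∉B) (⊆-trans (p─q⊆p X ⁅ s ⁆) X⊆S))
        (F⊆𝓘 s (X⊆S s∈X) s∉B C C-fund)
        s∈C C⊆X (circuit-modular circ s∈C C⊆X)
        where
        C⊆X : C ⊆ X
        C⊆X = ⊆-trans C⊆B∪s (∪-lub B⊆X (x∈p⇒⁅x⁆⊆p s∈X))

    ∈ideal⇒fundCircuitsIn : ∀ {B S} → 𝓘 S → IsBasisOf M B S → FundCircuitsIn M B S 𝓘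
    ∈ideal⇒fundCircuitsIn 𝓘S (B⊆S , _) s s∈S _ C (_ , _ , C⊆B∪s) =
      down-closed (⊆-trans C⊆B∪s (∪-lub B⊆S (x∈p⇒⁅x⁆⊆p s∈S))) 𝓘S

mainTheorem5 : ∀ {n : ℕ} (M : Matroid n) (𝓘 : Subset n → Set) →
    ModularIdeal M 𝓘 →
    ∀ S → 𝓘 S ⇔ (Independent M S ⊎ ∃ λ B → IsBasisOf M B S × FundCircuitsIn M B S 𝓘)
mainTheorem5 M 𝓘 𝓘-modular S = mk⇔ ∈ideal⇒characterised
  [ independent⇒∈ideal 𝓘-modular S
  , (λ (B , B-basis , F⊆𝓘) → basis-spanned⇒∈ideal 𝓘-modular B-basis F⊆𝓘 S (proj₁ B-basis) ⊆-refl) ]′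
  where
  open MatroidProperties M
  ∈ideal⇒characterised : 𝓘 S → Independent M S ⊎ ∃ λ B → IsBasisOf M B S × FundCircuitsIn M B S 𝓘
  ∈ideal⇒characterised 𝓘S =
    let (B , B-basis) = basis-exists S
    in inj₂ (B , B-basis , ∈ideal⇒fundCircuitsIn 𝓘-modular 𝓘S B-basis)
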